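{- Let $G$ and $H$ be two connected graphs with $G\neq K_1$ and $H\neq K_2$. (i) If $|\mathrm{Aut}(G)|=1$, then $D'(G\circ H)\leqslant \min\{D'(H),|V(H)|\}$. (ii) If $|V(G)|\leqslant |V(H)|+1$ and $D'(H)=1$, then $D'(G\circ H)\leqslant 2$.
   Context: $K_1$, $K_2$ are the complete graphs on one and two vertices; $\mathrm{Aut}(\cdot)$ is the automorphism group. The corona $G\circ H$ is obtained by taking one copy of $G$ and $|V(G)|$ copies of $H$ and joining the $i$-th vertex of $G$ to every vertex of the $i$-th copy of $H$. The distinguishing index $D'(G)$ is the least $d$ such that some edge colouring $E(G)\to\{1,\dots,d\}$ (not necessarily proper) is preserved by no non-identity automorphism of $G$ (acting on edges). -}

module Defs where

open import Data.Nat using (ℕ; zero; suc; _+_; _*_; _≤_)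
open import Data.Fin using (Fin; zero; suc; splitAt; remQuot; _≟_)
open import Data.Fin.Permutation using (Permutation; Permutation′; _⟨$⟩ʳ_)
open import Data.Bool using (Bool; true; false; not; _∧_)
open import Data.Bool.Properties using (∧-comm)
open import Data.Sum using (_⊎_; inj₁; inj₂)
open import Data.Sum as Sum using ()
open import Data.Product using (_×_; _,_; Σ; ∃)
open import Relation.Nullary using (yes; no; ¬_)
open import Relation.Nullary.Decidable using (⌊_⌋)
open import Relation.Binary.PropositionalEquality using (_≡_; refl; sym; cong)

record Graph : Set where
  field
    n      : ℕ
    adj    : Fin n → Fin n → Bool
    adj-sym : ∀ i j → adj i j ≡ adj j i
    irrefl : ∀ i → adj i i ≡ false
open Graph public

data Walk (G : Graph) : Fin (n G) → Fin (n G) → Set where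
  here : ∀ {i} → Walk G i i
  step : ∀ {i j k} → adj G i j ≡ true → Walk G j k → Walk G i k

Connected : Graph → Set
Connected G = (1 ≤ n G) × (∀ i j → Walk G i j)

Iso : Graph → Graph → Set
Iso G H = Σ (Permutation (n G) (n H)) λ π →
  ∀ i j → adj H (π ⟨$⟩ʳ i) (π ⟨$⟩ʳ j) ≡ adj G i j

eqb : ∀ {m} → Fin m → Fin m → Bool
eqb i j = ⌊ i ≟ j ⌋

eqb-sym : ∀ {m} (i j : Fin m) → eqb i j ≡ eqb j i
eqb-sym i j with i ≟ j | j ≟ i
... | yes _ | yes _ = refl
... | no  _ | no  _ = refl
... | yes p | no ¬q = Data.Empty.⊥-elim (¬q (sym p)) where import Data.Empty
... | no ¬p | yes q = Data.Empty.⊥-elim (¬p (sym q)) where import Data.Empty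

K₁ : Graph
K₁ = record { n = 1 ; adj = λ _ _ → false ; adj-sym = λ _ _ → refl ; irrefl = λ _ → refl }

K₂ : Graph
K₂ = record { n = 2 ; adj = λ i j → not (eqb i j)
            ; adj-sym = λ i j → cong not (eqb-sym i j) ; irrefl = irr }
  where
  irr : ∀ i → not (eqb i i) ≡ false
  irr zero = refl
  irr (suc zero) = refl

IsAut : (G : Graph) → Permutation′ (n G) → Set
IsAut G π = ∀ i j → adj G (π ⟨$⟩ʳ i) (π ⟨$⟩ʳ j) ≡ adj G i j

Asymmetric : Graph → Set
Asymmetric G = ∀ (π : Permutation′ (n G)) → IsAut G π → ∀ i → π ⟨$⟩ʳ i ≡ i

-- Corona G ∘ H
-- vertices: Fin (nG + nG * nH); the first nG are the vertices of G,
-- vertex (nG + combine i a) is vertex a of the i-th copy of H.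

module _ (G H : Graph) where
  private
    P = Fin (n G) ⊎ (Fin (n G) × Fin (n H))

  coronaAdjP : P → P → Bool
  coronaAdjP (inj₁ i) (inj₁ j) = adj G i j
  coronaAdjP (inj₁ i) (inj₂ (j , b)) = eqb i j
  coronaAdjP (inj₂ (i , a)) (inj₁ j) = eqb i j
  coronaAdjP (inj₂ (i , a)) (inj₂ (j , b)) = eqb i j ∧ adj H a b

  coronaAdjP-sym : ∀ u v → coronaAdjP u v ≡ coronaAdjP v u
  coronaAdjP-sym (inj₁ i) (inj₁ j) = adj-sym G i j
  coronaAdjP-sym (inj₁ i) (inj₂ (j , b)) = eqb-sym i j
  coronaAdjP-sym (inj₂ (i , a)) (inj₁ j) = eqb-sym i j
  coronaAdjP-sym (inj₂ (i , a)) (inj₂ (j , b))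
    rewrite eqb-sym i j | adj-sym H a b = refl

  coronaAdjP-irr : ∀ u → coronaAdjP u u ≡ false
  coronaAdjP-irr (inj₁ i) = irrefl G i
  coronaAdjP-irr (inj₂ (i , a)) rewrite irrefl H a = ∧-comm (eqb i i) false

  coronaPos : Fin (n G + n G * n H) → P
  coronaPos v = Sum.map₂ (remQuot (n H)) (splitAt (n G) v)

  corona : Graph
  corona = record
    { n = n G + n G * n H
    ; adj = λ u v → coronaAdjP (coronaPos u) (coronaPos v)
    ; adj-sym = λ u v → coronaAdjP-sym (coronaPos u) (coronaPos v)
    ; irrefl = λ u → coronaAdjP-irr (coronaPos u)
    }

_∘ᶜ_ : Graph → Graph → Graph
G ∘ᶜ H = corona G H

-- an edge colouring with colours Fin d: a colour for every edge {i,j},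
-- represented on ordered adjacent pairs, symmetric on edges
record EdgeColouring (G : Graph) (d : ℕ) : Set where
  field
    col     : Fin (n G) → Fin (n G) → Fin d
    col-sym : ∀ i j → adj G i j ≡ true → col i j ≡ col j i
open EdgeColouring public

Preserves : (G : Graph) {d : ℕ} → EdgeColouring G d → Permutation′ (n G) → Set
Preserves G c π = ∀ i j → adj G i j ≡ true → col c (π ⟨$⟩ʳ i) (π ⟨$⟩ʳ j) ≡ col c i j

EdgeTrivial : (G : Graph) → Permutation′ (n G) → Set
EdgeTrivial G π = ∀ i j → adj G i j ≡ true →
  ((π ⟨$⟩ʳ i ≡ i) × (π ⟨$⟩ʳ j ≡ j)) ⊎ ((π ⟨$⟩ʳ i ≡ j) × (π ⟨$⟩ʳ j ≡ i))

Distinguishing : (G : Graph) {d : ℕ} → EdgeColouring G d → Set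
Distinguishing G c = ∀ π → IsAut G π → Preserves G c π → EdgeTrivial G π

HasDistColouring : Graph → ℕ → Set
HasDistColouring G d = ∃ λ (c : EdgeColouring G d) → Distinguishing G c

DistIndex : Graph → ℕ → Set
DistIndex G d = HasDistColouring G d × (∀ k → HasDistColouring G k → d ≤ k)

-- Let G have no isolated vertex. In G ∘ H the vertices of the copies of H are exactly the
-- vertices with a neighbour u such that every other neighbour is adjacent to u (u is the
-- base vertex of the copy); a base vertex i is not of this kind, as it has a neighbour in G
-- and one in its copy. So every automorphism of G ∘ H maps base to base and the i-th copy
-- onto the σ(i)-th copy: it is an automorphism σ of G together with automorphisms τᵢ of H.
-- For connected H ≠ K₂ an automorphism fixing every edge fixes every vertex. Hence:
-- colouring each copy by a distinguishing colouring of H, or the spoke from i to vertex a of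
-- its copy by a, forces τᵢ = id, and σ = id when G is asymmetric; if D'(H) = 1 the τᵢ are
-- trivial anyway, and colouring the spoke (i, a) by whether a < i forces σ = id, because
-- the at most |V(H)| + 1 base vertices are separated by these thresholds.
module Submission where

open import Defs
open import Data.Nat using (ℕ; _≤_; _+_; _⊓_; _*_)
open import Data.Product using (_×_)
open import Relation.Nullary using (¬_)

open import Data.Nat using (_<_; _<ᵇ_)
open import Data.Nat.Properties
  using (<-cmp; <-irrefl; <-≤-trans; <ᵇ⇒<; <⇒<ᵇ; m<1+n⇒m≤n; +-comm; ⊓-sel)
open import Data.Fin using (Fin; toℕ; fromℕ<; _↑ˡ_; _↑ʳ_; combine; splitAt; join; _≟_)
open import Data.Fin.Properties
  using (any?; toℕ-injective; toℕ<n; toℕ-fromℕ<; splitAt-↑ˡ; splitAt-↑ʳ;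
         remQuot-combine; combine-remQuot; join-splitAt; 2↔Bool)
open import Data.Fin.Permutation using (Permutation′; _⟨$⟩ʳ_; _⟨$⟩ˡ_; permutation; inverseˡ; inverseʳ)
open import Data.Bool using (Bool; true; false; not; _∧_; T)
open import Data.Bool.Properties using (∧-conicalˡ; ∧-conicalʳ; T-≡)
open import Data.Sum using (_⊎_; inj₁; inj₂)
open import Data.Sum.Properties using (inj₁-injective; inj₂-injective)
open import Data.Product using (Σ; ∃; ∃₂; _,_; proj₁; proj₂; uncurry)
open import Function using (_∘_; Inverse; Equivalence)
open import Relation.Nullary using (yes; no; ¬?; contradiction)
open import Relation.Nullary.Decidable using (dec-true; isYes≗does; toWitness; decidable-stable)
open import Relation.Unary using (Pred; Decidable)
open import Relation.Binary.Definitions using (tri<; tri≈; tri>)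
open import Relation.Binary.PropositionalEquality
  using (_≡_; _≢_; refl; sym; trans; cong; cong₂; subst; module ≡-Reasoning)

eqb-refl : ∀ {m} (i : Fin m) → eqb i i ≡ true
eqb-refl i = trans (isYes≗does (i ≟ i)) (dec-true (i ≟ i) refl)

eqb⇒≡ : ∀ {m} {i j : Fin m} → eqb i j ≡ true → i ≡ j
eqb⇒≡ e = toWitness (Equivalence.from T-≡ e)

adj⇒≢ : ∀ G {i j} → adj G i j ≡ true → i ≢ j
adj⇒≢ G {i} e refl = contradiction (trans (sym e) (irrefl G i)) λ ()

walk⇒neighbour : ∀ G {i j} → Walk G i j → i ≢ j → ∃ λ k → adj G i k ≡ true
walk⇒neighbour G here       i≢i = contradiction refl i≢i
walk⇒neighbour G (step e _) _   = _ , e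

walk⇒leavingEdge : ∀ G {p} {S : Pred (Fin (n G)) p} → Decidable S → ∀ {x y} →
  Walk G x y → S x → ¬ S y → ∃₂ λ u v → S u × adj G u v ≡ true × ¬ S v
walk⇒leavingEdge G S? here Sx ¬Sy = contradiction Sx ¬Sy
walk⇒leavingEdge G S? {x} (step {j = z} e w) Sx ¬Sy with S? z
... | yes Sz = walk⇒leavingEdge G S? w Sz ¬Sy
... | no ¬Sz = x , z , Sx , e , ¬Sz

single-vertex⇒Iso-K₁ : ∀ G i → (∀ j → j ≡ i) → Iso G K₁
single-vertex⇒Iso-K₁ G i only =
  permutation (λ _ → Fin.zero) (λ _ → i) (λ { Fin.zero → refl ; (Fin.suc ()) }) (sym ∘ only) , noEdge
  where
  noEdge : ∀ x y → false ≡ adj G x y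
  noEdge x y rewrite only x | only y = sym (irrefl G i)

hasNeighbour : ∀ G → Connected G → ¬ Iso G K₁ → ∀ i → ∃ λ j → adj G i j ≡ true
hasNeighbour G (_ , walk) G≉K₁ i with any? (λ j → ¬? (j ≟ i))
... | yes (j , j≢i) = walk⇒neighbour G (walk i j) (j≢i ∘ sym)
... | no  none      =
  contradiction (single-vertex⇒Iso-K₁ G i λ j → decidable-stable (j ≟ i) (none ∘ (j ,_))) G≉K₁

module _ (H : Graph) where

  _∈⟨_,_⟩ : Fin (n H) → Fin (n H) → Fin (n H) → Set
  x ∈⟨ a , c ⟩ = x ≡ a ⊎ x ≡ c

  ∈⟨_,_⟩? : ∀ a c → Decidable (_∈⟨ a , c ⟩)
  ∈⟨ a , c ⟩? x with x ≟ a | x ≟ c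
  ... | yes x≡a | _       = yes (inj₁ x≡a)
  ... | no  _   | yes x≡c = yes (inj₂ x≡c)
  ... | no  x≢a | no  x≢c = no λ { (inj₁ x≡a) → x≢a x≡a ; (inj₂ x≡c) → x≢c x≡c }

  spanning-edge⇒Iso-K₂ : ∀ {a c} → adj H a c ≡ true → (∀ x → x ∈⟨ a , c ⟩) → Iso H K₂
  spanning-edge⇒Iso-K₂ {a} {c} ac onEdge = permutation to from to-from from-to , adjacency
    where
    to : Fin (n H) → Fin 2
    to x with x ≟ a
    ... | yes _ = Fin.zero
    ... | no  _ = Fin.suc Fin.zero
    from : Fin 2 → Fin (n H)
    from Fin.zero = a
    from (Fin.suc Fin.zero) = c
    to-a : to a ≡ Fin.zero
    to-a with a ≟ a
    ... | yes _   = refl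
    ... | no  a≢a = contradiction refl a≢a
    to-c : to c ≡ Fin.suc Fin.zero
    to-c with c ≟ a
    ... | yes c≡a = contradiction (sym c≡a) (adj⇒≢ H ac)
    ... | no  _   = refl
    to-from : ∀ y → to (from y) ≡ y
    to-from Fin.zero = to-a
    to-from (Fin.suc Fin.zero) = to-c
    from-to : ∀ x → from (to x) ≡ x
    from-to x with onEdge x
    ... | inj₁ refl rewrite to-a = refl
    ... | inj₂ refl rewrite to-c = refl
    adjacency : ∀ x y → not (eqb (to x) (to y)) ≡ adj H x y
    adjacency x y with onEdge x | onEdge y
    ... | inj₁ refl | inj₁ refl rewrite to-a        = sym (irrefl H a)
    ... | inj₁ refl | inj₂ refl rewrite to-a | to-c = sym ac
    ... | inj₂ refl | inj₁ refl rewrite to-a | to-c = sym (trans (adj-sym H c a) ac)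
    ... | inj₂ refl | inj₂ refl rewrite to-c        = sym (irrefl H c)

  -- An edge uv leaving {a, c} (u inside) is neither fixed, as τ u ≠ u, nor swapped, as τ u ∈ {a, c} ∌ v.
  swapped-edge-spans : Connected H → (τ : Permutation′ (n H)) → EdgeTrivial H τ →
    ∀ {a c} → τ ⟨$⟩ʳ a ≡ c → τ ⟨$⟩ʳ c ≡ a → adj H a c ≡ true → ∀ x → x ∈⟨ a , c ⟩
  swapped-edge-spans (_ , walk) τ trivial {a} {c} τa≡c τc≡a ac x with ∈⟨ a , c ⟩? x
  ... | yes x∈ = x∈
  ... | no  x∉ with walk⇒leavingEdge H ∈⟨ a , c ⟩? (walk a x) (inj₁ refl) x∉
  ...   | u , v , u∈ , uv , v∉ with trivial u v uv | u∈
  ...     | inj₁ (τu≡u , _) | inj₁ refl = contradiction (trans (sym τu≡u) τa≡c) (adj⇒≢ H ac)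
  ...     | inj₁ (τu≡u , _) | inj₂ refl = contradiction (trans (sym τc≡a) τu≡u) (adj⇒≢ H ac)
  ...     | inj₂ (τu≡v , _) | inj₁ refl = contradiction (inj₂ (trans (sym τu≡v) τa≡c)) v∉
  ...     | inj₂ (τu≡v , _) | inj₂ refl = contradiction (inj₁ (trans (sym τu≡v) τc≡a)) v∉

  edgeTrivial⇒identity : Connected H → ¬ Iso H K₂ →
    (τ : Permutation′ (n H)) → EdgeTrivial H τ → ∀ a → τ ⟨$⟩ʳ a ≡ a
  edgeTrivial⇒identity conn@(_ , walk) H≉K₂ τ trivial a with any? (λ b → ¬? (b ≟ a))
  ... | no  none      = decidable-stable (τ ⟨$⟩ʳ a ≟ a) (none ∘ (τ ⟨$⟩ʳ a ,_))
  ... | yes (b , b≢a) with walk⇒neighbour H (walk a b) (b≢a ∘ sym)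
  ...   | c , ac with trivial a c ac
  ...     | inj₁ (τa≡a , _)     = τa≡a
  ...     | inj₂ (τa≡c , τc≡a) =
    contradiction (spanning-edge⇒Iso-K₂ ac (swapped-edge-spans conn τ trivial τa≡c τc≡a ac)) H≉K₂

distinguishing-1⇒edgeTrivial : ∀ H → HasDistColouring H 1 →
  ∀ τ → IsAut H τ → EdgeTrivial H τ
distinguishing-1⇒edgeTrivial H (c , distinguishing) τ aut =
  distinguishing τ aut λ _ _ _ → oneColour _ _
  where
  oneColour : (x y : Fin 1) → x ≡ y
  oneColour Fin.zero Fin.zero = refl

-- Dominated vertices and automorphisms of a graph on an arbitrary type

module _ {X : Set} (E : X → X → Bool) where

  Dominated : X → Set
  Dominated x = Σ X λ u → E x u ≡ true × (∀ w → E x w ≡ true → w ≡ u ⊎ E u w ≡ true)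

  record Automorphism : Set where
    field
      to from : X → X
      to-from : ∀ x → to (from x) ≡ x
      from-to : ∀ x → from (to x) ≡ x
      to-adj  : ∀ x y → E (to x) (to y) ≡ E x y

    from-adj : ∀ x y → E (from x) (from y) ≡ E x y
    from-adj x y = trans (sym (to-adj (from x) (from y))) (cong₂ E (to-from x) (to-from y))

  inverse : Automorphism → Automorphism
  inverse φ = record { to = from ; from = to ; to-from = from-to ; from-to = to-from ; to-adj = from-adj }
    where open Automorphism φ

  dominated-invariant : (φ : Automorphism) → ∀ {x} → Dominated x → Dominated (Automorphism.to φ x)
  dominated-invariant φ {x} (u , xu , dom) = to u , trans (to-adj x u) xu , dom′
    where
    open Automorphism φ
    dom′ : ∀ w → E (to x) w ≡ true → w ≡ to u ⊎ E (to u) w ≡ true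
    dom′ w e with dom (from w) (trans (sym (to-adj x (from w))) (trans (cong (E (to x)) (to-from w)) e))
    ... | inj₁ w′≡u  = inj₁ (trans (sym (to-from w)) (cong to w′≡u))
    ... | inj₂ uw′   = inj₂ (trans (cong (E (to u)) (sym (to-from w))) (trans (to-adj u (from w)) uw′))

-- Automorphisms of the corona

-- Vertices of G ∘ H are handled through `Pos`: `inj₁ i` is the base vertex i, `inj₂ (i , a)`
-- is vertex a of the i-th copy of H.
module Corona (G H : Graph) where

  Pos : Set
  Pos = Fin (n G) ⊎ (Fin (n G) × Fin (n H))

  adjᴾ : Pos → Pos → Bool
  adjᴾ = coronaAdjP G H

  pos : Fin (n G + n G * n H) → Pos
  pos = coronaPos G H

  vertex : Pos → Fin (n G + n G * n H)
  vertex (inj₁ i) = i ↑ˡ (n G * n H)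
  vertex (inj₂ p) = n G ↑ʳ uncurry combine p

  pos-vertex : ∀ p → pos (vertex p) ≡ p
  pos-vertex (inj₁ i) rewrite splitAt-↑ˡ (n G) i (n G * n H) = refl
  pos-vertex (inj₂ (i , a)) rewrite splitAt-↑ʳ (n G) (n G * n H) (combine i a)
                                  | remQuot-combine {n G} {n H} i a = refl

  vertex-pos : ∀ v → vertex (pos v) ≡ v
  vertex-pos v with splitAt (n G) v in eq
  ... | inj₁ i = trans (cong (join (n G) (n G * n H)) (sym eq)) (join-splitAt (n G) (n G * n H) v)
  ... | inj₂ x = trans (cong (n G ↑ʳ_) (combine-remQuot {n G} (n H) x))
                   (trans (cong (join (n G) (n G * n H)) (sym eq)) (join-splitAt (n G) (n G * n H) v))

  positionAut : (π : Permutation′ (n (G ∘ᶜ H))) → IsAut (G ∘ᶜ H) π → Automorphism adjᴾ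
  positionAut π aut = record
    { to      = λ p → pos (π ⟨$⟩ʳ vertex p)
    ; from    = λ p → pos (π ⟨$⟩ˡ vertex p)
    ; to-from = λ p → trans (cong (λ v → pos (π ⟨$⟩ʳ v)) (vertex-pos _))
                        (trans (cong pos (inverseʳ π)) (pos-vertex p))
    ; from-to = λ p → trans (cong (λ v → pos (π ⟨$⟩ˡ v)) (vertex-pos _))
                        (trans (cong pos (inverseˡ π)) (pos-vertex p))
    ; to-adj  = λ p q → trans (aut (vertex p) (vertex q)) (cong₂ adjᴾ (pos-vertex p) (pos-vertex q))
    }

  leaf-dominated : ∀ i a → Dominated adjᴾ (inj₂ (i , a))
  leaf-dominated i a = inj₁ i , eqb-refl i , dom
    where
    dom : ∀ w → adjᴾ (inj₂ (i , a)) w ≡ true → w ≡ inj₁ i ⊎ adjᴾ (inj₁ i) w ≡ true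
    dom (inj₁ j)       e = inj₁ (cong inj₁ (sym (eqb⇒≡ e)))
    dom (inj₂ (j , b)) e = inj₂ (∧-conicalˡ (eqb i j) (adj H a b) e)

  base-undominated : (∀ i → ∃ λ j → adj G i j ≡ true) → Fin (n H) →
    ∀ i → ¬ Dominated adjᴾ (inj₁ i)
  base-undominated neighbour a₀ i (inj₁ j , ij , dom) with dom (inj₂ (i , a₀)) (eqb-refl i)
  ... | inj₂ ji = adj⇒≢ G ij (sym (eqb⇒≡ ji))
  base-undominated neighbour a₀ i (inj₂ (j , b) , ij , dom) with eqb⇒≡ ij | neighbour i
  ... | refl | k , ik with dom (inj₁ k) ik
  ...   | inj₂ ik′ = adj⇒≢ G ik (eqb⇒≡ ik′)

  module _ (neighbour : ∀ i → ∃ λ j → adj G i j ≡ true) (a₀ : Fin (n H)) where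

    base↦base : (φ : Automorphism adjᴾ) → ∀ i → ∃ λ j → Automorphism.to φ (inj₁ i) ≡ inj₁ j
    base↦base φ i with Automorphism.to φ (inj₁ i) in eq
    ... | inj₁ j       = j , refl
    ... | inj₂ (j , b) = contradiction
      (subst (Dominated adjᴾ) (trans (cong (Automorphism.from φ) (sym eq)) (Automorphism.from-to φ (inj₁ i)))
             (dominated-invariant adjᴾ (inverse adjᴾ φ) (leaf-dominated j b)))
      (base-undominated neighbour a₀ i)

    module Spine (φ : Automorphism adjᴾ) where
      open Automorphism φ

      σ : Fin (n G) → Fin (n G)
      σ i = proj₁ (base↦base φ i)

      to-base : ∀ i → to (inj₁ i) ≡ inj₁ (σ i)
      to-base i = proj₂ (base↦base φ i)

      leaf↦leaf : ∀ i a → ∃ λ b → to (inj₂ (i , a)) ≡ inj₂ (σ i , b)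
      leaf↦leaf i a with to (inj₂ (i , a)) in eq
      ... | inj₁ j = contradiction (trans (sym (from-to _)) (cong from eq)) (leaf≢base j)
        where
        leaf≢base : ∀ j → inj₂ (i , a) ≢ from (inj₁ j)
        leaf≢base j e with () ← trans e (proj₂ (base↦base (inverse adjᴾ φ) j))
      ... | inj₂ (k , b) = b , cong (λ x → inj₂ (x , b)) (sym (eqb⇒≡ σi~k))
        where
        σi~k : eqb (σ i) k ≡ true
        σi~k = trans (cong₂ adjᴾ (sym (to-base i)) (sym eq))
                     (trans (to-adj (inj₁ i) (inj₂ (i , a))) (eqb-refl i))

      τ : Fin (n G) → Fin (n H) → Fin (n H)
      τ i a = proj₁ (leaf↦leaf i a)

      to-leaf : ∀ i a → to (inj₂ (i , a)) ≡ inj₂ (σ i , τ i a)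
      to-leaf i a = proj₂ (leaf↦leaf i a)

    module Decomposition (φ : Automorphism adjᴾ) where
      open Automorphism φ
      open Spine φ public
      private module φ⁻¹ = Spine (inverse adjᴾ φ)

      σ⁻¹σ : ∀ i → φ⁻¹.σ (σ i) ≡ i
      σ⁻¹σ i = inj₁-injective (trans (sym (φ⁻¹.to-base (σ i)))
                                     (trans (cong from (sym (to-base i))) (from-to _)))

      σσ⁻¹ : ∀ i → σ (φ⁻¹.σ i) ≡ i
      σσ⁻¹ i = inj₁-injective (trans (sym (to-base (φ⁻¹.σ i)))
                                     (trans (cong to (sym (φ⁻¹.to-base i))) (to-from _)))

      baseAut : Permutation′ (n G)
      baseAut = permutation σ φ⁻¹.σ σσ⁻¹ σ⁻¹σ

      baseAut-isAut : IsAut G baseAut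
      baseAut-isAut i j = trans (cong₂ adjᴾ (sym (to-base i)) (sym (to-base j))) (to-adj (inj₁ i) (inj₁ j))

      ττ⁻¹ : ∀ i b → τ i (φ⁻¹.τ (σ i) b) ≡ b
      ττ⁻¹ i b = cong proj₂ (inj₂-injective (begin
        inj₂ (σ i , τ i (φ⁻¹.τ (σ i) b))         ≡⟨ sym (to-leaf i _) ⟩
        to (inj₂ (i , φ⁻¹.τ (σ i) b))            ≡⟨ cong (λ x → to (inj₂ (x , φ⁻¹.τ (σ i) b))) (sym (σ⁻¹σ i)) ⟩
        to (inj₂ (φ⁻¹.σ (σ i) , φ⁻¹.τ (σ i) b)) ≡⟨ cong to (sym (φ⁻¹.to-leaf (σ i) b)) ⟩
        to (from (inj₂ (σ i , b)))               ≡⟨ to-from _ ⟩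
        inj₂ (σ i , b)                           ∎))
        where open ≡-Reasoning

      τ⁻¹τ : ∀ i a → φ⁻¹.τ (σ i) (τ i a) ≡ a
      τ⁻¹τ i a = cong proj₂ (inj₂-injective (begin
        inj₂ (φ⁻¹.σ (σ i) , φ⁻¹.τ (σ i) (τ i a))  ≡⟨ sym (φ⁻¹.to-leaf (σ i) (τ i a)) ⟩
        from (inj₂ (σ i , τ i a))                 ≡⟨ cong from (sym (to-leaf i a)) ⟩
        from (to (inj₂ (i , a)))                  ≡⟨ from-to _ ⟩
        inj₂ (i , a)                              ∎))
        where open ≡-Reasoning

      copyAut : Fin (n G) → Permutation′ (n H)
      copyAut i = permutation (τ i) (φ⁻¹.τ (σ i)) (ττ⁻¹ i) (τ⁻¹τ i)

      copyAut-isAut : ∀ i → IsAut H (copyAut i)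
      copyAut-isAut i a b = begin
        adj H (τ i a) (τ i b)                               ≡⟨ cong (_∧ adj H (τ i a) (τ i b)) (sym (eqb-refl (σ i))) ⟩
        adjᴾ (inj₂ (σ i , τ i a)) (inj₂ (σ i , τ i b))      ≡⟨ cong₂ adjᴾ (sym (to-leaf i a)) (sym (to-leaf i b)) ⟩
        adjᴾ (to (inj₂ (i , a))) (to (inj₂ (i , b)))        ≡⟨ to-adj (inj₂ (i , a)) (inj₂ (i , b)) ⟩
        eqb i i ∧ adj H a b                                 ≡⟨ cong (_∧ adj H a b) (eqb-refl i) ⟩
        adj H a b                                           ∎
        where open ≡-Reasoning

constColouring : ∀ H {k} → Fin k → EdgeColouring H k
constColouring H c = record { col = λ _ _ → c ; col-sym = λ _ _ _ → refl }

module CoronaColouring (G H : Graph) {k : ℕ} (base : Fin k)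
                       (spoke : Fin (n G) → Fin (n H) → Fin k) (copy : EdgeColouring H k) where
  open Corona G H

  colourᴾ : Pos → Pos → Fin k
  colourᴾ (inj₁ _)       (inj₁ _)       = base
  colourᴾ (inj₁ i)       (inj₂ (_ , a)) = spoke i a
  colourᴾ (inj₂ (_ , a)) (inj₁ i)       = spoke i a
  colourᴾ (inj₂ (_ , a)) (inj₂ (_ , b)) = col copy a b

  colourᴾ-sym : ∀ p q → adjᴾ p q ≡ true → colourᴾ p q ≡ colourᴾ q p
  colourᴾ-sym (inj₁ _)       (inj₁ _)       _ = refl
  colourᴾ-sym (inj₁ _)       (inj₂ _)       _ = refl
  colourᴾ-sym (inj₂ _)       (inj₁ _)       _ = refl
  colourᴾ-sym (inj₂ (i , a)) (inj₂ (j , b)) e = col-sym copy a b (∧-conicalʳ (eqb i j) (adj H a b) e)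

  colouring : EdgeColouring (G ∘ᶜ H) k
  colouring = record { col = λ u v → colourᴾ (pos u) (pos v) ; col-sym = λ u v → colourᴾ-sym (pos u) (pos v) }

  PreservingPairsTrivial : Set
  PreservingPairsTrivial =
    ∀ (σ : Permutation′ (n G)) (τ : Fin (n G) → Permutation′ (n H)) →
      IsAut G σ → (∀ i → IsAut H (τ i)) →
      (∀ i a → spoke (σ ⟨$⟩ʳ i) (τ i ⟨$⟩ʳ a) ≡ spoke i a) → (∀ i → Preserves H copy (τ i)) →
      (∀ i → σ ⟨$⟩ʳ i ≡ i) × (∀ i a → τ i ⟨$⟩ʳ a ≡ a)

  distinguishing : (∀ i → ∃ λ j → adj G i j ≡ true) → Fin (n H) →
    PreservingPairsTrivial → Distinguishing (G ∘ᶜ H) colouring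
  distinguishing neighbour a₀ trivial π aut preserves = λ u v _ → inj₁ (fixed u , fixed v)
    where
    φ : Automorphism adjᴾ
    φ = positionAut π aut
    open Automorphism φ
    open Decomposition neighbour a₀ φ

    preservesᴾ : ∀ p q → adjᴾ p q ≡ true → colourᴾ (to p) (to q) ≡ colourᴾ p q
    preservesᴾ p q e =
      trans (preserves (vertex p) (vertex q) (trans (cong₂ adjᴾ (pos-vertex p) (pos-vertex q)) e))
            (cong₂ colourᴾ (pos-vertex p) (pos-vertex q))

    spoke-preserved : ∀ i a → spoke (σ i) (τ i a) ≡ spoke i a
    spoke-preserved i a = trans (cong₂ colourᴾ (sym (to-base i)) (sym (to-leaf i a)))
                                (preservesᴾ (inj₁ i) (inj₂ (i , a)) (eqb-refl i))

    copy-preserved : ∀ i → Preserves H copy (copyAut i)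
    copy-preserved i a b ab = trans (cong₂ colourᴾ (sym (to-leaf i a)) (sym (to-leaf i b)))
      (preservesᴾ (inj₂ (i , a)) (inj₂ (i , b)) (subst (λ x → x ∧ adj H a b ≡ true) (sym (eqb-refl i)) ab))

    trivialPair : (∀ i → σ i ≡ i) × (∀ i a → τ i a ≡ a)
    trivialPair = trivial baseAut copyAut baseAut-isAut copyAut-isAut spoke-preserved copy-preserved

    fixedᴾ : ∀ p → to p ≡ p
    fixedᴾ (inj₁ i)       = trans (to-base i) (cong inj₁ (proj₁ trivialPair i))
    fixedᴾ (inj₂ (i , a)) =
      trans (to-leaf i a) (cong₂ (λ x y → inj₂ (x , y)) (proj₁ trivialPair i) (proj₂ trivialPair i a))

    fixed : ∀ v → π ⟨$⟩ʳ v ≡ v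
    fixed v = begin
      π ⟨$⟩ʳ v                      ≡⟨ sym (vertex-pos _) ⟩
      vertex (pos (π ⟨$⟩ʳ v))       ≡⟨ cong (λ w → vertex (pos (π ⟨$⟩ʳ w))) (sym (vertex-pos v)) ⟩
      vertex (to (pos v))          ≡⟨ cong vertex (fixedᴾ (pos v)) ⟩
      vertex (pos v)               ≡⟨ vertex-pos v ⟩
      v                            ∎
      where open ≡-Reasoning

below : ∀ {m k} → Fin m → Fin k → Fin 2
below a i = Inverse.from 2↔Bool (toℕ a <ᵇ toℕ i)

module _ {m : ℕ} where

  strict⇒threshold-differs : ∀ {x y} → x < y → y ≤ m →
    ∃ λ (a : Fin m) → (toℕ a <ᵇ x) ≢ (toℕ a <ᵇ y)
  strict⇒threshold-differs {x} {y} x<y y≤m = a , differs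
    where
    a : Fin m
    a = fromℕ< (<-≤-trans x<y y≤m)
    differs : (toℕ a <ᵇ x) ≢ (toℕ a <ᵇ y)
    differs e rewrite toℕ-fromℕ< (<-≤-trans x<y y≤m) =
      <-irrefl refl (<ᵇ⇒< x x (subst T (sym e) (<⇒<ᵇ x<y)))

  threshold-injective : ∀ {x y} → x ≤ m → y ≤ m →
    (∀ (a : Fin m) → (toℕ a <ᵇ x) ≡ (toℕ a <ᵇ y)) → x ≡ y
  threshold-injective {x} {y} x≤m y≤m same with <-cmp x y
  ... | tri≈ _ x≡y _ = x≡y
  ... | tri< x<y _ _ = let a , differs = strict⇒threshold-differs x<y y≤m in contradiction (same a) differs
  ... | tri> _ _ y<x = let a , differs = strict⇒threshold-differs y<x x≤m in contradiction (sym (same a)) differs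

below-injective : ∀ {m k} {i j : Fin k} → (∀ i → toℕ i ≤ m) →
  (∀ (a : Fin m) → below a i ≡ below a j) → i ≡ j
below-injective {i = i} {j} bounded same = toℕ-injective (threshold-injective (bounded i) (bounded j) sameᵇ)
  where
  sameᵇ : ∀ a → (toℕ a <ᵇ toℕ i) ≡ (toℕ a <ᵇ toℕ j)
  sameᵇ a = trans (sym (Inverse.strictlyInverseˡ 2↔Bool _))
                  (trans (cong (Inverse.to 2↔Bool) (same a)) (Inverse.strictlyInverseˡ 2↔Bool _))

module _ (G H : Graph) (neighbour : ∀ i → ∃ λ j → adj G i j ≡ true) (a₀ : Fin (n H)) where

  asymmetric-copyColouring : Connected H → ¬ Iso H K₂ → Asymmetric G →
    ∀ {d} → HasDistColouring H d → HasDistColouring (G ∘ᶜ H) d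
  asymmetric-copyColouring connH H≉K₂ asym (c , c-dist) =
    colouring , distinguishing neighbour a₀ trivial
    where
    -- Base and spoke colours are arbitrary; col c a₀ a₀ merely exhibits an element of Fin d.
    open CoronaColouring G H (col c a₀ a₀) (λ _ _ → col c a₀ a₀) c
    trivial : PreservingPairsTrivial
    trivial σ τ σ-aut τ-aut _ τ-pres =
      asym σ σ-aut , λ i → edgeTrivial⇒identity H connH H≉K₂ (τ i) (c-dist (τ i) (τ-aut i) (τ-pres i))

  asymmetric-spokeColouring : Asymmetric G → HasDistColouring (G ∘ᶜ H) (n H)
  asymmetric-spokeColouring asym = colouring , distinguishing neighbour a₀ trivial
    where
    open CoronaColouring G H a₀ (λ _ a → a) (constColouring H a₀)
    trivial : PreservingPairsTrivial
    trivial σ τ σ-aut _ spoke-pres _ = asym σ σ-aut , spoke-pres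

  thresholdColouring : Connected H → ¬ Iso H K₂ → n G ≤ n H + 1 →
    (∀ τ → IsAut H τ → EdgeTrivial H τ) → HasDistColouring (G ∘ᶜ H) 2
  thresholdColouring connH H≉K₂ nG≤nH+1 allTrivial =
    colouring , distinguishing neighbour a₀ trivial
    where
    open CoronaColouring G H Fin.zero (λ i a → below a i) (constColouring H Fin.zero)
    bounded : ∀ (i : Fin (n G)) → toℕ i ≤ n H
    bounded i = m<1+n⇒m≤n (<-≤-trans (toℕ<n i) (subst (n G ≤_) (+-comm (n H) 1) nG≤nH+1))
    trivial : PreservingPairsTrivial
    trivial σ τ _ τ-aut spoke-pres _ = σ≡id , τ≡id
      where
      τ≡id : ∀ i a → τ i ⟨$⟩ʳ a ≡ a
      τ≡id i = edgeTrivial⇒identity H connH H≉K₂ (τ i) (allTrivial (τ i) (τ-aut i))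
      σ≡id : ∀ i → σ ⟨$⟩ʳ i ≡ i
      σ≡id i = below-injective bounded λ a →
        trans (cong (λ x → below x (σ ⟨$⟩ʳ i)) (sym (τ≡id i a))) (spoke-pres i a)

mainTheorem16 : (G H : Graph) → Connected G → Connected H →
    ¬ Iso G K₁ → ¬ Iso H K₂ →
    ((Asymmetric G → ∀ d → DistIndex H d → HasDistColouring (G ∘ᶜ H) (d ⊓ n H))
    × (n G ≤ n H + 1 → DistIndex H 1 → HasDistColouring (G ∘ᶜ H) 2))
mainTheorem16 G H connG connH G≉K₁ H≉K₂ = part-i , part-ii
  where
  neighbour : ∀ i → ∃ λ j → adj G i j ≡ true
  neighbour = hasNeighbour G connG G≉K₁
  a₀ : Fin (n H)
  a₀ = fromℕ< (proj₁ connH)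

  part-i : Asymmetric G → ∀ d → DistIndex H d → HasDistColouring (G ∘ᶜ H) (d ⊓ n H)
  part-i asym d (distH , _) with ⊓-sel d (n H)
  ... | inj₁ d⊓nH≡d  = subst (HasDistColouring (G ∘ᶜ H)) (sym d⊓nH≡d)
                         (asymmetric-copyColouring G H neighbour a₀ connH H≉K₂ asym distH)
  ... | inj₂ d⊓nH≡nH = subst (HasDistColouring (G ∘ᶜ H)) (sym d⊓nH≡nH)
                         (asymmetric-spokeColouring G H neighbour a₀ asym)

  part-ii : n G ≤ n H + 1 → DistIndex H 1 → HasDistColouring (G ∘ᶜ H) 2
  part-ii nG≤nH+1 (distH , _) =
    thresholdColouring G H neighbour a₀ connH H≉K₂ nG≤nH+1 (distinguishing-1⇒edgeTrivial H distH)
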